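{- Every derivation in $\mathsf{G3Kt}$ consisting solely of labeled polytree sequents can be effectively translated to a derivation in $\textsf{DKT}$.
   Context: Tense formulae: $A ::= p \mid \overline{p} \mid A\wedge A \mid A\vee A \mid \Box A \mid \Diamond A \mid \blacksquare A \mid \Diamond^{ - }A$, with $\Diamond^{ - }$ the past diamond. Labeled sequents $\mathcal{R},\Gamma$ (relational atoms $Rxy$, labeled formulae $x:A$); a labeled polytree sequent is one whose graph (labels as vertices, edge $(x,y)$ for $Rxy$) has a tree as underlying undirected graph. $\mathsf{G3Kt}$ has rules: $(\textsf{id})$ $\mathcal{R},x:p,x:\overline{p},\Gamma$; $(\vee)$,$(\wedge)$ labelwise; $(\Box)$ from $\mathcal{R},Rxy,y:A,\Gamma$ infer $\mathcal{R},x:\Box A,\Gamma$ ($y$ fresh); $(\Diamond)$ from $\mathcal{R},Rxy,y:A,x:\Diamond A,\Gamma$ infer $\mathcal{R},Rxy,x:\Diamond A,\Gamma$; $(\blacksquare)$ from $\mathcal{R},Ryx,y:A,\Gamma$ infer $\mathcal{R},x:\blacksquare A,\Gamma$ ($y$ fresh); $(\Diamond^{ - })$ from $\mathcal{R},Ryx,y:A,x:\Diamond^{ - }A,\Gamma$ infer $\mathcal{R},Ryx,x:\Diamond^{ - }A,\Gamma$. Nested sequents: $X ::= \varepsilon \mid A \mid X,X \mid \circ\{X\} \mid \bullet\{X\}$; $X[\,]$ denotes a context (a nested sequent with a hole, possibly deep inside nestings). The deep nested calculus $\textsf{DKT}$ has rules: $(\textsf{id})$ $X[p,\overline{p}]$;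 $(\wedge)$ from $X[A,Y]$ and $X[B,Y]$ infer $X[A\wedge B,Y]$; $(\vee)$ from $X[A,B,Y]$ infer $X[A\vee B,Y]$; $(\blacksquare)$ from $X[\blacksquare A,\bullet\{A\}]$ infer $X[\blacksquare A]$; $(\Box)$ from $X[\Box A,\circ\{A\}]$ infer $X[\Box A]$; $(\Diamond^{ - }_1)$ from $X[\bullet\{Y,A\},\Diamond^{ - }A]$ infer $X[\bullet\{Y\},\Diamond^{ - }A]$; $(\Diamond^{ - }_2)$ from $X[\circ\{Y,\Diamond^{ - }A\},A]$ infer $X[\circ\{Y,\Diamond^{ - }A\}]$; $(\Diamond_1)$ from $X[\circ\{Y,A\},\Diamond A]$ infer $X[\circ\{Y\},\Diamond A]$; $(\Diamond_2)$ from $X[\bullet\{Y,\Diamond A\},A]$ infer $X[\bullet\{Y,\Diamond A\}]$. The translation of a labeled polytree sequent to a nested sequent $\mathfrak{N}_x$ starts at a label $x$, puts the formulae labeled $x$ at top level, and recursively nests the subtree through each $Rxy$ under $\circ\{\cdot\}$ and through each $Rzx$ under $\bullet\{\cdot\}$; the translation of the derivation is sequent-wise under $\mathfrak{N}$. -}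

module Defs where

open import Data.Nat using (ℕ)
open import Data.Nat.Properties using (_≟_)
open import Data.Bool using (Bool; true; false; not; _∨_)
open import Data.List using (List; []; _∷_; _++_; map; filter; length; concatMap)
open import Data.List.Membership.Propositional using (_∈_; _∉_)
open import Data.List.Relation.Binary.Permutation.Propositional using (_↭_)
open import Data.Product using (Σ; _×_; _,_; proj₁; proj₂)
open import Function.Bundles using (_⇔_)
open import Relation.Nullary.Decidable using (⌊_⌋)

-- Tense formulae in negation normal form

data Fm : Set where
  at    : ℕ → Fm
  nat   : ℕ → Fm
  _∧ᶠ_  : Fm → Fm → Fm
  _∨ᶠ_  : Fm → Fm → Fm
  □     : Fm → Fm
  ◇     : Fm → Fm
  ■     : Fm → Fm
  ◇⁻    : Fm → Fm

-- Multisets are represented by lists; G3Kt derivations are closed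
-- under permutation of both lists (rule `ex`), i.e. sequents are
-- taken up to reordering, as multisets.

Rel : Set
Rel = ℕ × ℕ              -- (x , y) stands for R x y

LF : Set
LF = ℕ × Fm              -- (x , A) stands for x : A

Seq : Set
Seq = List Rel × List LF

labels : Seq → List ℕ
labels (R , Γ) = map proj₁ R ++ map proj₂ R ++ map proj₁ Γ

data G3Kt : Seq → Set where
  ax   : ∀ {R Γ x p} → G3Kt (R , (x , at p) ∷ (x , nat p) ∷ Γ)
  r∨   : ∀ {R Γ x A B} → G3Kt (R , (x , A) ∷ (x , B) ∷ Γ)
       → G3Kt (R , (x , A ∨ᶠ B) ∷ Γ)
  r∧   : ∀ {R Γ x A B} → G3Kt (R , (x , A) ∷ Γ) → G3Kt (R , (x , B) ∷ Γ)
       → G3Kt (R , (x , A ∧ᶠ B) ∷ Γ)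
  r□   : ∀ {R Γ x y A} → y ∉ labels (R , (x , □ A) ∷ Γ)
       → G3Kt ((x , y) ∷ R , (y , A) ∷ Γ)
       → G3Kt (R , (x , □ A) ∷ Γ)
  r◇   : ∀ {R Γ x y A} → G3Kt ((x , y) ∷ R , (y , A) ∷ (x , ◇ A) ∷ Γ)
       → G3Kt ((x , y) ∷ R , (x , ◇ A) ∷ Γ)
  r■   : ∀ {R Γ x y A} → y ∉ labels (R , (x , ■ A) ∷ Γ)
       → G3Kt ((y , x) ∷ R , (y , A) ∷ Γ)
       → G3Kt (R , (x , ■ A) ∷ Γ)
  r◇⁻  : ∀ {R Γ x y A} → G3Kt ((y , x) ∷ R , (y , A) ∷ (x , ◇⁻ A) ∷ Γ)
       → G3Kt ((y , x) ∷ R , (x , ◇⁻ A) ∷ Γ)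
  ex   : ∀ {R R′ Γ Γ′} → G3Kt (R , Γ) → R ↭ R′ → Γ ↭ Γ′ → G3Kt (R′ , Γ′)

-- Trees (undirected underlying graph), built by adding leaves.
-- TreeG V E : the graph with vertex list V and directed edge list E
-- has a tree as underlying undirected graph.

data TreeG : List ℕ → List Rel → Set where
  single : ∀ x → TreeG (x ∷ []) []
  addOut : ∀ {V E x y} → TreeG V E → x ∈ V → y ∉ V → TreeG (y ∷ V) ((x , y) ∷ E)
  addIn  : ∀ {V E x y} → TreeG V E → x ∈ V → y ∉ V → TreeG (y ∷ V) ((y , x) ∷ E)

Polytree : Seq → Set
Polytree (R , Γ) =
  Σ (List ℕ) λ V → Σ (List Rel) λ E →
    TreeG V E × (E ↭ R) × ((z : ℕ) → (z ∈ V) ⇔ (z ∈ labels (R , Γ)))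

AllPolytree : ∀ {S} → G3Kt S → Set
AllPolytree {S} ax          = Polytree S
AllPolytree {S} (r∨ d)      = Polytree S × AllPolytree d
AllPolytree {S} (r∧ d e)    = Polytree S × AllPolytree d × AllPolytree e
AllPolytree {S} (r□ _ d)    = Polytree S × AllPolytree d
AllPolytree {S} (r◇ d)      = Polytree S × AllPolytree d
AllPolytree {S} (r■ _ d)    = Polytree S × AllPolytree d
AllPolytree {S} (r◇⁻ d)     = Polytree S × AllPolytree d
AllPolytree {S} (ex d _ _)  = Polytree S × AllPolytree d

-- Nested sequents (lists, read as multisets via the exchange rule)

data Item : Set where
  fm : Fm → Item
  wh : List Item → Item
  bl : List Item → Item

NSeq : Set
NSeq = List Item

data Ctx : Set where
  hole : NSeq → NSeq → Ctx
  inWh : NSeq → Ctx → NSeq → Ctx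
  inBl : NSeq → Ctx → NSeq → Ctx

plug : Ctx → NSeq → NSeq
plug (hole L R) Z   = L ++ Z ++ R
plug (inWh L C R) Z = L ++ wh (plug C Z) ∷ R
plug (inBl L C R) Z = L ++ bl (plug C Z) ∷ R

data DKT : NSeq → Set where
  ax   : ∀ {X p} → DKT (plug X (fm (at p) ∷ fm (nat p) ∷ []))
  r∧   : ∀ {X A B} → DKT (plug X (fm A ∷ [])) → DKT (plug X (fm B ∷ []))
       → DKT (plug X (fm (A ∧ᶠ B) ∷ []))
  r∨   : ∀ {X A B} → DKT (plug X (fm A ∷ fm B ∷ []))
       → DKT (plug X (fm (A ∨ᶠ B) ∷ []))
  r■   : ∀ {X A} → DKT (plug X (fm (■ A) ∷ bl (fm A ∷ []) ∷ []))
       → DKT (plug X (fm (■ A) ∷ []))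
  r□   : ∀ {X A} → DKT (plug X (fm (□ A) ∷ wh (fm A ∷ []) ∷ []))
       → DKT (plug X (fm (□ A) ∷ []))
  r◇⁻₁ : ∀ {X Y A} → DKT (plug X (bl (fm A ∷ Y) ∷ fm (◇⁻ A) ∷ []))
       → DKT (plug X (bl Y ∷ fm (◇⁻ A) ∷ []))
  r◇⁻₂ : ∀ {X Y A} → DKT (plug X (wh (fm (◇⁻ A) ∷ Y) ∷ fm A ∷ []))
       → DKT (plug X (wh (fm (◇⁻ A) ∷ Y) ∷ []))
  r◇₁  : ∀ {X Y A} → DKT (plug X (wh (fm A ∷ Y) ∷ fm (◇ A) ∷ []))
       → DKT (plug X (wh Y ∷ fm (◇ A) ∷ []))
  r◇₂  : ∀ {X Y A} → DKT (plug X (bl (fm (◇ A) ∷ Y) ∷ fm A ∷ []))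
       → DKT (plug X (bl (fm (◇ A) ∷ Y) ∷ []))
  ex   : ∀ {X I J} → DKT (plug X (I ∷ J ∷ [])) → DKT (plug X (J ∷ I ∷ []))

-- Edges incident to x
-- are removed before recursing (so we never walk back); the fuel
-- (length of R) bounds the depth.

fmsAt : ℕ → List LF → NSeq
fmsAt x []            = []
fmsAt x ((y , A) ∷ Γ) with ⌊ x ≟ y ⌋
... | true  = fm A ∷ fmsAt x Γ
... | false = fmsAt x Γ

notIncident : ℕ → Rel → Bool
notIncident x (a , b) = not (⌊ x ≟ a ⌋ ∨ ⌊ x ≟ b ⌋)

mutual
  tr : ℕ → ℕ → List Rel → List LF → NSeq
  tr n x R Γ = fmsAt x Γ ++ kids n x R Γ

  kids : ℕ → ℕ → List Rel → List LF → NSeq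
  kids ℕ.zero    x R Γ = []
  kids (ℕ.suc n) x R Γ = concatMap step R
    where
    R′ : List Rel
    R′ = filter (λ e → Data.Bool.T? (notIncident x e)) R
    step : Rel → NSeq
    step (a , b) with ⌊ x ≟ a ⌋ | ⌊ x ≟ b ⌋
    ... | true  | _     = wh (tr n b R′ Γ) ∷ []
    ... | false | true  = bl (tr n a R′ Γ) ∷ []
    ... | false | false = []

𝔑 : ℕ → Seq → NSeq
𝔑 x (R , Γ) = tr (length R) x R Γ

-- Hang the polytree of a sequent from the root r. The formulae at any label x then occupy a
-- single position of the nested sequent 𝔑_r: it is a context with the formulae of x in its
-- hole, so the rules acting at one label (id, ∧, ∨) become the DKT rules in that context. An
-- edge between x and y makes y a child of x or x a child of y in the hung tree; these are the
-- two situations handled by DKT's ◇₁/◇₂ (resp. ◇⁻₁/◇⁻₂). The premise of □ or ■ attaches a fresh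
-- leaf y to x, which in the nesting is a new bracket ∘{A} or •{A} inside the content of x.
-- Since DKT's □, ■ keep the principal formula and G3Kt's drop it, the induction translates
-- sequents whose labels carry arbitrary extra content. Exchange is harmless because nested
-- sequents are compared up to permutation at every depth, which DKT's exchange makes admissible.

module Submission where

open import Defs
open import Data.Bool using (T; T?; if_then_else_)
open import Data.Empty using (⊥-elim)
open import Data.List using (List; []; _∷_; _++_; map; filter; concatMap; length)
open import Data.List.Properties
  using (++-assoc; ++-identityʳ; concatMap-cong; filter-accept; filter-reject; filter-all; filter-notAll)
open import Data.List.Membership.Propositional using (_∈_; _∉_)
open import Data.List.Membership.Propositional.Properties
  using (∈-filter⁻; ∈-++⁻; ∈-++⁺ˡ; ∈-++⁺ʳ; ∈-map⁺; ∈-map⁻)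
import Data.List.Relation.Unary.All as All
open import Data.List.Relation.Unary.Any as Any using (here; there)
open import Data.List.Relation.Binary.Subset.Propositional using (_⊆_)
open import Data.List.Relation.Binary.Permutation.Propositional using (_↭_)
import Data.List.Relation.Binary.Permutation.Propositional as ↭
import Data.List.Relation.Binary.Permutation.Propositional.Properties as ↭
open import Data.Nat using (ℕ; zero; suc; _≤_; _<_; s≤s)
open import Data.Nat.Properties using (_≟_; ≤-trans; ≤-pred; <⇒≤; ≤-reflexive)
open import Data.Product using (∃-syntax; _×_; _,_; proj₁; proj₂)
open import Data.Sum as Sum using (_⊎_; inj₁; inj₂)
open import Function using (_∘_; flip; id)
open import Function.Bundles using (Equivalence)
open import Relation.Nullary using (¬_; Dec; yes; no)
open import Relation.Nullary.Decidable using (⌊_⌋)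
open import Relation.Binary.PropositionalEquality as ≡
  using (_≡_; _≢_; _≗_; ≢-sym; refl; cong; cong₂; subst)

-- Nested sequents up to permutation at every depth

infix 4 _≈ᴵ_ _≋_

mutual
  data _≈ᴵ_ : Item → Item → Set where
    fm≈ : ∀ {A} → fm A ≈ᴵ fm A
    wh≈ : ∀ {L M} → L ≋ M → wh L ≈ᴵ wh M
    bl≈ : ∀ {L M} → L ≋ M → bl L ≈ᴵ bl M

  data _≋_ : NSeq → NSeq → Set where
    []    : [] ≋ []
    _∷_   : ∀ {I J L M} → I ≈ᴵ J → L ≋ M → I ∷ L ≋ J ∷ M
    swap  : ∀ {I J L} → I ∷ J ∷ L ≋ J ∷ I ∷ L
    trans : ∀ {L M N} → L ≋ M → M ≋ N → L ≋ N

mutual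
  ≈ᴵ-refl : ∀ I → I ≈ᴵ I
  ≈ᴵ-refl (fm A) = fm≈
  ≈ᴵ-refl (wh L) = wh≈ (≋-refl L)
  ≈ᴵ-refl (bl L) = bl≈ (≋-refl L)

  ≋-refl : ∀ L → L ≋ L
  ≋-refl []      = []
  ≋-refl (I ∷ L) = ≈ᴵ-refl I ∷ ≋-refl L

mutual
  ≈ᴵ-sym : ∀ {I J} → I ≈ᴵ J → J ≈ᴵ I
  ≈ᴵ-sym fm≈     = fm≈
  ≈ᴵ-sym (wh≈ p) = wh≈ (≋-sym p)
  ≈ᴵ-sym (bl≈ p) = bl≈ (≋-sym p)

  ≋-sym : ∀ {L M} → L ≋ M → M ≋ L
  ≋-sym []          = []
  ≋-sym (i ∷ p)     = ≈ᴵ-sym i ∷ ≋-sym p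
  ≋-sym swap        = swap
  ≋-sym (trans p q) = trans (≋-sym q) (≋-sym p)

≋-reflexive : ∀ {L M} → L ≡ M → L ≋ M
≋-reflexive {L} refl = ≋-refl L

++⁺ˡ : ∀ L {M M′} → M ≋ M′ → L ++ M ≋ L ++ M′
++⁺ˡ []      p = p
++⁺ˡ (I ∷ L) p = ≈ᴵ-refl I ∷ ++⁺ˡ L p

++⁺ʳ : ∀ {L L′} M → L ≋ L′ → L ++ M ≋ L′ ++ M
++⁺ʳ M []          = ≋-refl M
++⁺ʳ M (i ∷ p)     = i ∷ ++⁺ʳ M p
++⁺ʳ M swap        = swap
++⁺ʳ M (trans p q) = trans (++⁺ʳ M p) (++⁺ʳ M q)

++⁺ : ∀ {L L′ M M′} → L ≋ L′ → M ≋ M′ → L ++ M ≋ L′ ++ M′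
++⁺ {L′ = L′} {M} p q = trans (++⁺ʳ M p) (++⁺ˡ L′ q)

↭⇒≋ : ∀ {L M} → L ↭ M → L ≋ M
↭⇒≋ {L} ↭.refl     = ≋-refl L
↭⇒≋ (↭.prep I p)   = ≈ᴵ-refl I ∷ ↭⇒≋ p
↭⇒≋ (↭.swap I J p) = trans swap (≈ᴵ-refl J ∷ (≈ᴵ-refl I ∷ ↭⇒≋ p))
↭⇒≋ (↭.trans p q)  = trans (↭⇒≋ p) (↭⇒≋ q)

_∘ᶜ_ : Ctx → Ctx → Ctx
hole L R ∘ᶜ hole L′ R′     = hole (L ++ L′) (R′ ++ R)
hole L R ∘ᶜ inWh L′ D R′   = inWh (L ++ L′) D (R′ ++ R)
hole L R ∘ᶜ inBl L′ D R′   = inBl (L ++ L′) D (R′ ++ R)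
inWh L C R ∘ᶜ D = inWh L (C ∘ᶜ D) R
inBl L C R ∘ᶜ D = inBl L (C ∘ᶜ D) R

plug-∘ᶜ : ∀ C D Z → plug (C ∘ᶜ D) Z ≡ plug C (plug D Z)
plug-∘ᶜ (hole L R) (hole L′ R′) Z = begin
  (L ++ L′) ++ Z ++ R′ ++ R   ≡⟨ ++-assoc L L′ _ ⟩
  L ++ L′ ++ Z ++ R′ ++ R     ≡⟨ cong (λ u → L ++ L′ ++ u) (≡.sym (++-assoc Z R′ R)) ⟩
  L ++ L′ ++ (Z ++ R′) ++ R   ≡⟨ cong (L ++_) (≡.sym (++-assoc L′ (Z ++ R′) R)) ⟩
  L ++ (L′ ++ Z ++ R′) ++ R   ∎
  where open ≡.≡-Reasoning
plug-∘ᶜ (hole L R) (inWh L′ D R′) Z =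
  ≡.trans (++-assoc L L′ _) (cong (L ++_) (≡.sym (++-assoc L′ (wh (plug D Z) ∷ R′) R)))
plug-∘ᶜ (hole L R) (inBl L′ D R′) Z =
  ≡.trans (++-assoc L L′ _) (cong (L ++_) (≡.sym (++-assoc L′ (bl (plug D Z) ∷ R′) R)))
plug-∘ᶜ (inWh L C R) D Z = cong (λ u → L ++ wh u ∷ R) (plug-∘ᶜ C D Z)
plug-∘ᶜ (inBl L C R) D Z = cong (λ u → L ++ bl u ∷ R) (plug-∘ᶜ C D Z)

_⊕_ : Ctx → NSeq → Ctx
C ⊕ W = C ∘ᶜ hole [] W

plug-⊕ : ∀ C W Z → plug (C ⊕ W) Z ≡ plug C (Z ++ W)
plug-⊕ C W = plug-∘ᶜ C (hole [] W)

plug-cong : ∀ C {N N′} → N ≋ N′ → plug C N ≋ plug C N′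
plug-cong (hole L R)   p = ++⁺ˡ L (++⁺ʳ R p)
plug-cong (inWh L C R) p = ++⁺ˡ L (wh≈ (plug-cong C p) ∷ ≋-refl R)
plug-cong (inBl L C R) p = ++⁺ˡ L (bl≈ (plug-cong C p) ∷ ≋-refl R)

mutual
  DKT-resp-≋ᶜ : ∀ C {N N′} → N ≋ N′ → DKT (plug C N) → DKT (plug C N′)
  DKT-resp-≋ᶜ C [] d = d
  DKT-resp-≋ᶜ C (_∷_ {I} {M = M} i p) d =
    DKT-resp-≈ᴵ C M i
      (DKT-resp-under C (hole (I ∷ []) []) (I ∷_) (λ Z → cong (I ∷_) (++-identityʳ Z)) p d)
  DKT-resp-≋ᶜ C (swap {I} {J} {L}) d =
    subst DKT (plug-⊕ C L (J ∷ I ∷ []))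
      (ex {X = C ⊕ L} (subst DKT (≡.sym (plug-⊕ C L (I ∷ J ∷ []))) d))
  DKT-resp-≋ᶜ C (trans p q) d = DKT-resp-≋ᶜ C q (DKT-resp-≋ᶜ C p d)

  DKT-resp-≈ᴵ : ∀ C M {I J} → I ≈ᴵ J → DKT (plug C (I ∷ M)) → DKT (plug C (J ∷ M))
  DKT-resp-≈ᴵ C M fm≈    d = d
  DKT-resp-≈ᴵ C M (wh≈ q) d =
    DKT-resp-under C (inWh [] (hole [] []) M) (λ Z → wh Z ∷ M)
      (λ Z → cong (λ u → wh u ∷ M) (++-identityʳ Z)) q d
  DKT-resp-≈ᴵ C M (bl≈ q) d =
    DKT-resp-under C (inBl [] (hole [] []) M) (λ Z → bl Z ∷ M)
      (λ Z → cong (λ u → bl u ∷ M) (++-identityʳ Z)) q d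

  DKT-resp-under : ∀ C D (F : NSeq → NSeq) → (∀ Z → plug D Z ≡ F Z) →
                   ∀ {Z Z′} → Z ≋ Z′ → DKT (plug C (F Z)) → DKT (plug C (F Z′))
  DKT-resp-under C D F plugD {Z} {Z′} p d =
    subst DKT (plug-∘ᶜD Z′) (DKT-resp-≋ᶜ (C ∘ᶜ D) p (subst DKT (≡.sym (plug-∘ᶜD Z)) d))
    where
    plug-∘ᶜD : ∀ Z → plug (C ∘ᶜ D) Z ≡ plug C (F Z)
    plug-∘ᶜD Z = ≡.trans (plug-∘ᶜ C D Z) (cong (plug C) (plugD Z))

DKT-resp-≋ : ∀ {N N′} → N ≋ N′ → DKT N → DKT N′
DKT-resp-≋ {N} {N′} p d =
  subst DKT (++-identityʳ N′) (DKT-resp-≋ᶜ (hole [] []) p (subst DKT (≡.sym (++-identityʳ N)) d))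

-- Seen from x, the neighbour y of the atom edge d x y is nested as bracket d:
-- ∘{…} for R x y and •{…} for R y x.
data Dir : Set where
  future past : Dir

opposite : Dir → Dir
opposite future = past
opposite past   = future

edge : Dir → ℕ → ℕ → Rel
edge future x y = x , y
edge past   x y = y , x

bracket : Dir → NSeq → Item
bracket future = wh
bracket past   = bl

inBracket : Dir → NSeq → Ctx → NSeq → Ctx
inBracket future = inWh
inBracket past   = inBl

bracket-cong : ∀ d {L M} → L ≋ M → bracket d L ≈ᴵ bracket d M
bracket-cong future = wh≈
bracket-cong past   = bl≈

plug-inBracket : ∀ d L C R Z → plug (inBracket d L C R) Z ≡ L ++ bracket d (plug C Z) ∷ R
plug-inBracket future L C R Z = refl
plug-inBracket past   L C R Z = refl

Incident : ℕ → Rel → Set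
Incident w (a , b) = w ≡ a ⊎ w ≡ b

Touches : List Rel → ℕ → Set
Touches L w = ∃[ e ] e ∈ L × Incident w e

Loopless : List Rel → Set
Loopless L = ∀ {a b} → (a , b) ∈ L → a ≢ b

source-incident : ∀ d {x y} → Incident x (edge d x y)
source-incident future = inj₁ refl
source-incident past   = inj₂ refl

target-incident : ∀ d {x y} → Incident y (edge d x y)
target-incident future = inj₂ refl
target-incident past   = inj₁ refl

Incident-edge⁻ : ∀ d {c x y} → Incident c (edge d x y) → c ≡ x ⊎ c ≡ y
Incident-edge⁻ future i         = i
Incident-edge⁻ past   (inj₁ eq) = inj₂ eq
Incident-edge⁻ past   (inj₂ eq) = inj₁ eq

edge-≡⁻ : ∀ d d′ {x y x′ y′} → edge d x y ≡ edge d′ x′ y′ →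
  (d ≡ d′ × x ≡ x′ × y ≡ y′) ⊎ (d ≡ opposite d′ × x ≡ y′ × y ≡ x′)
edge-≡⁻ future future refl = inj₁ (refl , refl , refl)
edge-≡⁻ future past   refl = inj₂ (refl , refl , refl)
edge-≡⁻ past   future refl = inj₂ (refl , refl , refl)
edge-≡⁻ past   past   refl = inj₁ (refl , refl , refl)

Loopless-edge : ∀ {L} → Loopless L → ∀ d {x y} → edge d x y ∈ L → x ≢ y
Loopless-edge ℓ future e∈L = ℓ e∈L
Loopless-edge ℓ past   e∈L = ≢-sym (ℓ e∈L)

T-notIncident⁻ : ∀ c e → T (notIncident c e) → ¬ Incident c e
T-notIncident⁻ c (a , b) t (inj₁ refl) with c ≟ c
... | yes _   = t
... | no c≢c = c≢c refl
T-notIncident⁻ c (a , b) t (inj₂ refl) with c ≟ a | c ≟ c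
... | yes _ | _      = t
... | no _  | yes _  = t
... | no _  | no c≢c = c≢c refl

T-notIncident⁺ : ∀ c e → ¬ Incident c e → T (notIncident c e)
T-notIncident⁺ c (a , b) ¬i with c ≟ a | c ≟ b
... | yes c≡a | _       = ¬i (inj₁ c≡a)
... | no _    | yes c≡b = ¬i (inj₂ c≡b)
... | no _    | no _    = _

dropIncident : ℕ → List Rel → List Rel
dropIncident c = filter (λ e → T? (notIncident c e))

dropIncident-incident : ∀ c {e} L → Incident c e → dropIncident c (e ∷ L) ≡ dropIncident c L
dropIncident-incident c {e} L i = filter-reject (λ e → T? (notIncident c e)) (λ t → T-notIncident⁻ c e t i)

dropIncident-away : ∀ c {e} L → ¬ Incident c e → dropIncident c (e ∷ L) ≡ e ∷ dropIncident c L
dropIncident-away c {e} L ¬i = filter-accept (λ e → T? (notIncident c e)) (T-notIncident⁺ c e ¬i)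

dropIncident-untouched : ∀ c L → ¬ Touches L c → dropIncident c L ≡ L
dropIncident-untouched c L ¬t =
  filter-all (λ e → T? (notIncident c e)) (All.tabulate λ e∈L → T-notIncident⁺ c _ λ i → ¬t (_ , e∈L , i))

dropIncident-shorter : ∀ c {e} L → e ∈ L → Incident c e → length (dropIncident c L) < length L
dropIncident-shorter c {e} L e∈L i =
  filter-notAll (λ e → T? (notIncident c e)) L (Any.map (λ { refl t → T-notIncident⁻ c e t i }) e∈L)

∈-dropIncident⁻ : ∀ c {e} L → e ∈ dropIncident c L → e ∈ L × ¬ Incident c e
∈-dropIncident⁻ c {e} L e∈ with ∈-filter⁻ (λ e → T? (notIncident c e)) {xs = L} e∈
... | e∈L , t = e∈L , T-notIncident⁻ c e t

Touches-dropIncident⁻ : ∀ c {w} L → Touches (dropIncident c L) w → w ≢ c × Touches L w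
Touches-dropIncident⁻ c L (e , e∈ , i) with ∈-dropIncident⁻ c L e∈
... | e∈L , ¬i = (λ { refl → ¬i i }) , (e , e∈L , i)

Loopless-dropIncident : ∀ c L → Loopless L → Loopless (dropIncident c L)
Loopless-dropIncident c L ℓ e∈ = ℓ (proj₁ (∈-dropIncident⁻ c L e∈))

-- The translation with arbitrary contents at the labels

Content : Set
Content = ℕ → NSeq

infixl 6 _[_≔_]

_[_≔_] : Content → ℕ → NSeq → Content
(f [ z ≔ W ]) w = if ⌊ w ≟ z ⌋ then W else f w

update-≡ : ∀ f z W → (f [ z ≔ W ]) z ≡ W
update-≡ f z W with z ≟ z
... | yes _   = refl
... | no z≢z = ⊥-elim (z≢z refl)

update-≢ : ∀ f {z w} W → w ≢ z → (f [ z ≔ W ]) w ≡ f w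
update-≢ f {z} {w} W w≢z with w ≟ z
... | yes w≡z = ⊥-elim (w≢z w≡z)
... | no _    = refl

update-cong : ∀ {f g} z W → f ≗ g → f [ z ≔ W ] ≗ g [ z ≔ W ]
update-cong z W f≗g w with w ≟ z
... | yes _ = refl
... | no _  = f≗g w

update-absorb : ∀ f z U W → f [ z ≔ U ] [ z ≔ W ] ≗ f [ z ≔ W ]
update-absorb f z U W w with w ≟ z
... | yes _ = refl
... | no _  = refl

update-comm : ∀ f {x y} U W → x ≢ y → f [ x ≔ U ] [ y ≔ W ] ≗ f [ y ≔ W ] [ x ≔ U ]
update-comm f {x} {y} U W x≢y w with w ≟ x | w ≟ y
... | yes refl | yes refl = ⊥-elim (x≢y refl)
... | yes refl | no _     = refl
... | no _     | yes refl = refl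
... | no _     | no _     = refl

mutual
  nest : ℕ → ℕ → List Rel → Content → NSeq
  nest n x R f = f x ++ nestKids n x R f

  nestKids : ℕ → ℕ → List Rel → Content → NSeq
  nestKids zero    x R f = []
  nestKids (suc n) x R f = concatMap (nestEdge n x (dropIncident x R) f) R

  nestEdge : ℕ → ℕ → List Rel → Content → Rel → NSeq
  nestEdge n x R f (a , b) =
    if ⌊ x ≟ a ⌋ then wh (nest n b R f) ∷ []
    else if ⌊ x ≟ b ⌋ then bl (nest n a R f) ∷ []
    else []

-- Names the anonymous where-function `step` of kids, so that it can be compared with nestEdge.
kids-step : ∀ n x R Γ → ∃[ F ] kids (suc n) x R Γ ≡ concatMap F R
kids-step n x R Γ = _ , refl

mutual
  tr≡nest : ∀ n x R Γ → tr n x R Γ ≡ nest n x R (λ w → fmsAt w Γ)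
  tr≡nest n x R Γ = cong (fmsAt x Γ ++_) (kids≡nestKids n x R Γ)

  kids≡nestKids : ∀ n x R Γ → kids n x R Γ ≡ nestKids n x R (λ w → fmsAt w Γ)
  kids≡nestKids zero    x R Γ = refl
  kids≡nestKids (suc n) x R Γ = ≡.trans (proj₂ (kids-step n x R Γ)) (concatMap-cong step≗nestEdge R)
    where
    step≗nestEdge : proj₁ (kids-step n x R Γ) ≗ nestEdge n x (dropIncident x R) (λ w → fmsAt w Γ)
    step≗nestEdge (a , b) with x ≟ a | x ≟ b
    ... | yes _ | _     = cong (λ u → wh u ∷ []) (tr≡nest n b (dropIncident x R) Γ)
    ... | no _  | yes _ = cong (λ u → bl u ∷ []) (tr≡nest n a (dropIncident x R) Γ)
    ... | no _  | no _  = refl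

nestEdge-toward : ∀ n d {x y} R f → x ≢ y → nestEdge n x R f (edge d x y) ≡ bracket d (nest n y R f) ∷ []
nestEdge-toward n future {x} R f _ with x ≟ x
... | yes _   = refl
... | no x≢x = ⊥-elim (x≢x refl)
nestEdge-toward n past {x} {y} R f x≢y with x ≟ y | x ≟ x
... | yes x≡y | _       = ⊥-elim (x≢y x≡y)
... | no _    | yes _   = refl
... | no _    | no x≢x = ⊥-elim (x≢x refl)

nestEdge-away : ∀ n {x} R f e → ¬ Incident x e → nestEdge n x R f e ≡ []
nestEdge-away n {x} R f (a , b) ¬i with x ≟ a | x ≟ b
... | yes x≡a | _       = ⊥-elim (¬i (inj₁ x≡a))
... | no _    | yes x≡b = ⊥-elim (¬i (inj₂ x≡b))
... | no _    | no _    = refl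

nestEdge-cong : ∀ {n m x R₁ R₂ f g} e →
  (x ≡ proj₁ e → nest n (proj₂ e) R₁ f ≋ nest m (proj₂ e) R₂ g) →
  (x ≢ proj₁ e → x ≡ proj₂ e → nest n (proj₁ e) R₁ f ≋ nest m (proj₁ e) R₂ g) →
  nestEdge n x R₁ f e ≋ nestEdge m x R₂ g e
nestEdge-cong {x = x} (a , b) toB toA with x ≟ a | x ≟ b
... | yes x≡a | _       = wh≈ (toB x≡a) ∷ []
... | no x≢a  | yes x≡b = bl≈ (toA x≢a x≡b) ∷ []
... | no _    | no _    = []

concatMap-cong-∈ : ∀ {F G : Rel → NSeq} L → (∀ {e} → e ∈ L → F e ≋ G e) → concatMap F L ≋ concatMap G L
concatMap-cong-∈ []      h = []
concatMap-cong-∈ (e ∷ L) h = ++⁺ (h (here refl)) (concatMap-cong-∈ L (h ∘ there))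

concatMap-↭ : ∀ (F : Rel → NSeq) {L L′} → L ↭ L′ → concatMap F L ≋ concatMap F L′
concatMap-↭ F ↭.refl          = ≋-refl _
concatMap-↭ F (↭.prep e p)    = ++⁺ˡ (F e) (concatMap-↭ F p)
concatMap-↭ F (↭.swap e e′ p) =
  trans (↭⇒≋ (↭.shifts (F e) (F e′))) (++⁺ˡ (F e′) (++⁺ˡ (F e) (concatMap-↭ F p)))
concatMap-↭ F (↭.trans p q)   = trans (concatMap-↭ F p) (concatMap-↭ F q)

nestEdge-fromTarget : ∀ n d {x y} R f → y ≢ x →
  nestEdge n y R f (edge d x y) ≡ bracket (opposite d) (nest n x R f) ∷ []
nestEdge-fromTarget n future = nestEdge-toward n past
nestEdge-fromTarget n past   = nestEdge-toward n future

concatMap-≡[] : ∀ {F : Rel → NSeq} L → (∀ {e} → e ∈ L → F e ≡ []) → concatMap F L ≡ []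
concatMap-≡[] []      h = refl
concatMap-≡[] (e ∷ L) h = cong₂ _++_ (h (here refl)) (concatMap-≡[] L (h ∘ there))

nestKids-[] : ∀ n x f → nestKids n x [] f ≡ []
nestKids-[] zero    x f = refl
nestKids-[] (suc n) x f = refl

nestKids-untouched : ∀ n c L f → ¬ Touches L c → nestKids n c L f ≡ []
nestKids-untouched zero    c L f ¬t = refl
nestKids-untouched (suc n) c L f ¬t =
  concatMap-≡[] L λ {e} e∈L → nestEdge-away n _ f e λ i → ¬t (e , e∈L , i)

nestKids-incident : ∀ k c {e} L f → Incident c e →
  nestKids (suc k) c (e ∷ L) f ≡ nestEdge k c (dropIncident c L) f e ++ nestKids (suc k) c L f
nestKids-incident k c {e} L f i =
  cong (λ R → nestEdge k c R f e ++ concatMap (nestEdge k c R f) L) (dropIncident-incident c L i)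

nestKids-away : ∀ k c {e} L f → ¬ Incident c e →
  nestKids (suc k) c (e ∷ L) f ≡ concatMap (nestEdge k c (e ∷ dropIncident c L) f) L
nestKids-away k c {e} L f ¬i =
  ≡.trans (cong (λ R → nestEdge k c R f e ++ concatMap (nestEdge k c R f) L) (dropIncident-away c L ¬i))
          (cong (_++ concatMap (nestEdge k c (e ∷ dropIncident c L) f) L) (nestEdge-away k _ f e ¬i))

mutual
  nest-cong : ∀ n c L {f g} → (∀ w → f w ≋ g w) → nest n c L f ≋ nest n c L g
  nest-cong n c L f≋g = ++⁺ (f≋g c) (nestKids-cong n c L f≋g)

  nestKids-cong : ∀ n c L {f g} → (∀ w → f w ≋ g w) → nestKids n c L f ≋ nestKids n c L g
  nestKids-cong zero    c L f≋g = []
  nestKids-cong (suc n) c L {f} {g} f≋g = concatMap-cong-∈ L λ {e} _ →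
    nestEdge-cong {n} {n} {c} {dropIncident c L} {dropIncident c L} {f} {g} e
      (λ _ → nest-cong n _ _ f≋g) (λ _ _ → nest-cong n _ _ f≋g)

mutual
  nest-local : ∀ n c L {f g} → Loopless L → f c ≋ g c →
               (∀ w → w ≢ c → Touches L w → f w ≋ g w) → nest n c L f ≋ nest n c L g
  nest-local n c L ℓ fc≋gc h = ++⁺ fc≋gc (nestKids-local n c L ℓ h)

  nestKids-local : ∀ n c L {f g} → Loopless L →
                   (∀ w → w ≢ c → Touches L w → f w ≋ g w) → nestKids n c L f ≋ nestKids n c L g
  nestKids-local zero    c L ℓ h = []
  nestKids-local (suc n) c L {f} {g} ℓ h = concatMap-cong-∈ L λ { {a , b} ab∈L →
    nestEdge-cong {n} {n} {c} {L′} {L′} {f} {g} (a , b)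
      (λ { refl → nest-local n b L′ ℓ′ (h b (≢-sym (ℓ ab∈L)) (_ , ab∈L , inj₂ refl)) h′ })
      (λ { _ refl → nest-local n a L′ ℓ′ (h a (ℓ ab∈L) (_ , ab∈L , inj₁ refl)) h′ }) }
    where
    L′ = dropIncident c L
    ℓ′ = Loopless-dropIncident c L ℓ
    h′ : ∀ {v} w → w ≢ v → Touches L′ w → f w ≋ g w
    h′ w _ t with Touches-dropIncident⁻ c L t
    ... | w≢c , t′ = h w w≢c t′

nest-↭ : ∀ n c {L L′} f → L ↭ L′ → nest n c L f ≋ nest n c L′ f
nest-↭ zero    c f p = ≋-refl _
nest-↭ (suc n) c {L} {L′} f p = ++⁺ˡ (f c) (trans (concatMap-↭ _ p)
  (concatMap-cong-∈ L′ λ {e} _ → nestEdge-cong {n} {n} {c} {dropIncident c L} {dropIncident c L′} {f} {f} e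
    (λ _ → nest-↭ n _ f p′) (λ _ _ → nest-↭ n _ f p′)))
  where p′ = ↭.filter-↭ (λ e → T? (notIncident c e)) p

nest-fuel : ∀ n c L f → length L ≤ n → nest (suc n) c L f ≋ nest n c L f
nest-fuel zero    c []      f _  = ≋-refl _
nest-fuel (suc n) c L f L≤ = ++⁺ˡ (f c) (concatMap-cong-∈ L λ { {a , b} ab∈L →
  nestEdge-cong {suc n} {n} {c} {L′} {L′} {f} {f} (a , b)
    (λ c≡a → nest-fuel n b L′ f (shorter ab∈L (inj₁ c≡a)))
    (λ _ c≡b → nest-fuel n a L′ f (shorter ab∈L (inj₂ c≡b))) })
  where
  L′ = dropIncident c L
  shorter : ∀ {e} → e ∈ L → Incident c e → length L′ ≤ n
  shorter e∈L i = ≤-pred (≤-trans (dropIncident-shorter c L e∈L i) L≤)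

nest-leafRoot : ∀ k d {x y} L f → y ≢ x → ¬ Touches L y →
  nest (suc k) y (edge d x y ∷ L) f ≡ f y ++ bracket (opposite d) (nest k x L f) ∷ []
nest-leafRoot k d {x} {y} L f y≢x ¬t = cong (f y ++_) (begin
  nestKids (suc k) y (edge d x y ∷ L) f
    ≡⟨ nestKids-incident k y L f (target-incident d) ⟩
  nestEdge k y (dropIncident y L) f (edge d x y) ++ nestKids (suc k) y L f
    ≡⟨ cong₂ (λ R K → nestEdge k y R f (edge d x y) ++ K)
             (dropIncident-untouched y L ¬t) (nestKids-untouched (suc k) y L f ¬t) ⟩
  nestEdge k y L f (edge d x y) ++ []
    ≡⟨ cong (_++ []) (nestEdge-fromTarget k d L f y≢x) ⟩
  bracket (opposite d) (nest k x L f) ∷ [] ∎)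
  where open ≡.≡-Reasoning

graft : Dir → Content → ℕ → ℕ → Content
graft d f x y = f [ x ≔ f x ++ bracket d (f y) ∷ [] ]

nest-attachLeaf : ∀ n c d {x y} L f → x ≢ y → ¬ Touches L y → c ≢ y → length L < n → Loopless L →
  nest n c (edge d x y ∷ L) f ≋ nest n c L (graft d f x y)
nest-attachLeaf (suc k) c d {x} {y} L f x≢y ¬t c≢y L< ℓ with c ≟ x
... | yes refl = trans (≋-reflexive attached) (++⁺ˡ (f c ++ bracket d (f y) ∷ [])
      (nestKids-local (suc k) c L ℓ λ w w≢c _ → ≋-reflexive (≡.sym (update-≢ f _ w≢c))))
  where
  open ≡.≡-Reasoning
  L′ = dropIncident c L
  ¬t′ : ¬ Touches L′ y
  ¬t′ = ¬t ∘ proj₂ ∘ Touches-dropIncident⁻ c L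
  attached : nest (suc k) c (edge d c y ∷ L) f ≡ (f c ++ bracket d (f y) ∷ []) ++ nestKids (suc k) c L f
  attached = begin
    f c ++ nestKids (suc k) c (edge d c y ∷ L) f
      ≡⟨ cong (f c ++_) (nestKids-incident k c L f (source-incident d)) ⟩
    f c ++ nestEdge k c L′ f (edge d c y) ++ nestKids (suc k) c L f
      ≡⟨ cong (λ u → f c ++ u ++ nestKids (suc k) c L f) (nestEdge-toward k d L′ f x≢y) ⟩
    f c ++ bracket d (f y ++ nestKids k y L′ f) ∷ nestKids (suc k) c L f
      ≡⟨ cong (λ u → f c ++ bracket d u ∷ nestKids (suc k) c L f)
              (≡.trans (cong (f y ++_) (nestKids-untouched k y L′ f ¬t′)) (++-identityʳ (f y))) ⟩
    f c ++ bracket d (f y) ∷ nestKids (suc k) c L f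
      ≡⟨ ≡.sym (++-assoc (f c) _ _) ⟩
    (f c ++ bracket d (f y) ∷ []) ++ nestKids (suc k) c L f ∎
... | no c≢x = trans (≋-reflexive (cong (f c ++_) (nestKids-away k c L f c∉xy)))
      (++⁺ˡ (f c) (concatMap-cong-∈ L λ { {a , b} ab∈L →
        nestEdge-cong {k} {k} {c} {edge d x y ∷ L′} {L′} {f} {graft d f x y} (a , b)
          (λ c≡a → nest-attachLeaf k b d L′ f x≢y ¬t′ (λ { refl → ¬t (_ , ab∈L , inj₂ refl) })
                     (shorter ab∈L (inj₁ c≡a)) ℓ′)
          (λ _ c≡b → nest-attachLeaf k a d L′ f x≢y ¬t′ (λ { refl → ¬t (_ , ab∈L , inj₁ refl) })
                     (shorter ab∈L (inj₂ c≡b)) ℓ′) }))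
  where
  L′ = dropIncident c L
  c∉xy : ¬ Incident c (edge d x y)
  c∉xy i with Incident-edge⁻ d i
  ... | inj₁ c≡x = c≢x c≡x
  ... | inj₂ c≡y = c≢y c≡y
  ¬t′ : ¬ Touches L′ y
  ¬t′ = ¬t ∘ proj₂ ∘ Touches-dropIncident⁻ c L
  ℓ′ = Loopless-dropIncident c L ℓ
  shorter : ∀ {e} → e ∈ L → Incident c e → length L′ < k
  shorter e∈L i = ≤-trans (dropIncident-shorter c L e∈L i) (≤-pred L<)

-- Trees hung from a root

data Tree : List ℕ → List Rel → Set where
  single : ∀ x → Tree (x ∷ []) []
  grow   : ∀ {V E x y} d → Tree V E → x ∈ V → y ∉ V → Tree (y ∷ V) (edge d x y ∷ E)

fromTreeG : ∀ {V E} → TreeG V E → Tree V E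
fromTreeG (single x)         = single x
fromTreeG (addOut T x∈V y∉V) = grow future (fromTreeG T) x∈V y∉V
fromTreeG (addIn  T x∈V y∉V) = grow past   (fromTreeG T) x∈V y∉V

∈-∉-≢ : ∀ {V : List ℕ} {x y} → x ∈ V → y ∉ V → x ≢ y
∈-∉-≢ x∈V y∉V refl = y∉V x∈V

Tree-touches : ∀ {V E w} → Tree V E → Touches E w → w ∈ V
Tree-touches (single x) (_ , () , _)
Tree-touches (grow d T x∈V y∉V) (_ , here refl , i) with Incident-edge⁻ d i
... | inj₁ refl = there x∈V
... | inj₂ refl = here refl
Tree-touches (grow d T x∈V y∉V) (e , there e∈E , i) = there (Tree-touches T (e , e∈E , i))

Tree-untouched : ∀ {V E y} → Tree V E → y ∉ V → ¬ Touches E y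
Tree-untouched T y∉V = y∉V ∘ Tree-touches T

Tree-loopless : ∀ {V E} → Tree V E → Loopless E
Tree-loopless (single x) ()
Tree-loopless (grow future T x∈V y∉V) (here refl) = ∈-∉-≢ x∈V y∉V
Tree-loopless (grow past   T x∈V y∉V) (here refl) = ≢-sym (∈-∉-≢ x∈V y∉V)
Tree-loopless (grow d      T x∈V y∉V) (there e∈E) = Tree-loopless T e∈E

Tree-touches-edge : ∀ {V E} → Tree V E → ∀ d {x y} → edge d x y ∈ E → x ∈ V × y ∈ V
Tree-touches-edge T d e∈E =
  Tree-touches T (_ , e∈E , source-incident d) , Tree-touches T (_ , e∈E , target-incident d)

graft-update-leaf : ∀ d f {x y} W w → x ≢ y → w ≢ y →
  graft d (f [ y ≔ W ]) x y w ≡ (f [ x ≔ f x ++ bracket d W ∷ [] ]) w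
graft-update-leaf d f {x} {y} W w x≢y w≢y with w ≟ x
... | yes refl = cong₂ (λ U V → U ++ bracket d V ∷ []) (update-≢ f W x≢y) (update-≡ f y W)
... | no _     = update-≢ f W w≢y

graft-update-parent : ∀ d f {x y} W → x ≢ y →
  graft d (f [ x ≔ W ]) x y ≗ f [ x ≔ W ++ bracket d (f y) ∷ [] ]
graft-update-parent d f {x} {y} W x≢y w with w ≟ x
... | yes refl = cong₂ (λ U V → U ++ bracket d V ∷ []) (update-≡ f x W) (update-≢ f W (≢-sym x≢y))
... | no _     = refl

graft-update-other : ∀ d f {x y z} W → z ≢ x → z ≢ y →
  graft d (f [ z ≔ W ]) x y ≗ graft d f x y [ z ≔ W ]
graft-update-other d f {x} {y} {z} W z≢x z≢y w with w ≟ x | w ≟ z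
... | yes refl | yes refl = ⊥-elim (z≢x refl)
... | yes refl | no _     =
  cong₂ (λ U V → U ++ bracket d V ∷ []) (update-≢ f W (≢-sym z≢x)) (update-≢ f W (≢-sym z≢y))
... | no _     | yes refl = refl
... | no _     | no _     = refl

record Focus (n r : ℕ) (E : List Rel) (f : Content) (z : ℕ) : Set where
  constructor _,_
  field
    context   : Ctx
    nest≋plug : ∀ W → nest n r E (f [ z ≔ W ]) ≋ plug context W

-- f is quantified because removing the last leaf moves its content into that of its parent.
focus : ∀ {V E} → Tree V E → ∀ {n} → length E ≤ n → ∀ {r z} → r ∈ V → z ∈ V → ∀ f → Focus n r E f z
focus (single x) {n} _ (here refl) (here refl) f =
  hole [] [] , λ W → ≋-reflexive (cong₂ _++_ (update-≡ f x W) (nestKids-[] n x _))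
focus (grow {E = E} {x = x} {y = y} d T x∈V y∉V) {suc k} (s≤s E≤k) (here refl) (here refl) f =
  hole [] (bracket (opposite d) (nest k x E f) ∷ []) , λ W →
    trans (≋-reflexive (nest-leafRoot k d E (f [ y ≔ W ]) y≢x (Tree-untouched T y∉V)))
      (++⁺ (≋-reflexive (update-≡ f y W)) (bracket-cong (opposite d)
        (nest-local k x E (Tree-loopless T) (≋-reflexive (update-≢ f W x≢y))
          λ w _ t → ≋-reflexive (update-≢ f W (∈-∉-≢ (Tree-touches T t) y∉V))) ∷ []))
  where
  x≢y = ∈-∉-≢ x∈V y∉V
  y≢x = ≢-sym x≢y
focus (grow {E = E} {x = x} {y = y} d T x∈V y∉V) {suc k} (s≤s E≤k) (here refl) (there z∈V) f
  with focus T E≤k x∈V z∈V f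
... | C , nest≋C = inBracket (opposite d) (f y) C [] , λ W →
  trans (≋-reflexive (nest-leafRoot k d E (f [ _ ≔ W ]) (≢-sym (∈-∉-≢ x∈V y∉V)) (Tree-untouched T y∉V)))
    (trans (++⁺ (≋-reflexive (update-≢ f W (≢-sym (∈-∉-≢ z∈V y∉V))))
                (bracket-cong (opposite d) (nest≋C W) ∷ []))
      (≋-reflexive (≡.sym (plug-inBracket (opposite d) (f y) C [] W))))
focus (grow {V} {E} {x} {y} d T x∈V y∉V) {suc k} E<n {r} (there r∈V) (here refl) f
  with focus T (<⇒≤ E<n) r∈V x∈V f
... | C , nest≋C = C ∘ᶜ inBracket d (f x) (hole [] []) [] , λ W →
  trans (nest-attachLeaf (suc k) r d E (f [ y ≔ W ]) x≢y ¬t (∈-∉-≢ r∈V y∉V) E<n ℓ)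
    (trans (nest-local (suc k) r E ℓ (leaf W r∈V) λ w _ t → leaf W (Tree-touches T t))
      (trans (nest≋C (f x ++ bracket d W ∷ []))
        (≋-reflexive (≡.sym (≡.trans (plug-∘ᶜ C _ W)
          (cong (plug C) (≡.trans (plug-inBracket d (f x) (hole [] []) [] W)
            (cong (λ u → f x ++ bracket d u ∷ []) (++-identityʳ W)))))))))
  where
  x≢y = ∈-∉-≢ x∈V y∉V
  ¬t = Tree-untouched T y∉V
  ℓ = Tree-loopless T
  leaf : ∀ W {w} → w ∈ V → graft d (f [ y ≔ W ]) x y w ≋ (f [ x ≔ f x ++ bracket d W ∷ [] ]) w
  leaf W w∈V = ≋-reflexive (graft-update-leaf d f W _ x≢y (∈-∉-≢ w∈V y∉V))
focus (grow {E = E} {x = x} {y = y} d T x∈V y∉V) {suc k} E<n {r} {z} (there r∈V) (there z∈V) f with z ≟ x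
... | yes refl with focus T (<⇒≤ E<n) r∈V x∈V f
...   | C , nest≋C = C ⊕ (bracket d (f y) ∷ []) , λ W →
  trans (nest-attachLeaf (suc k) r d E (f [ z ≔ W ]) x≢y (Tree-untouched T y∉V) (∈-∉-≢ r∈V y∉V) E<n
                         (Tree-loopless T))
    (trans (nest-cong (suc k) r E (≋-reflexive ∘ graft-update-parent d f W x≢y))
      (trans (nest≋C (W ++ bracket d (f y) ∷ [])) (≋-reflexive (≡.sym (plug-⊕ C _ W)))))
  where x≢y = ∈-∉-≢ x∈V y∉V
focus (grow {E = E} {x = x} {y = y} d T x∈V y∉V) {suc k} E<n {r} {z} (there r∈V) (there z∈V) f | no z≢x
  with focus T (<⇒≤ E<n) r∈V z∈V (graft d f x y)
... | C , nest≋C = C , λ W →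
  trans (nest-attachLeaf (suc k) r d E (f [ z ≔ W ]) (∈-∉-≢ x∈V y∉V) (Tree-untouched T y∉V) (∈-∉-≢ r∈V y∉V) E<n
                         (Tree-loopless T))
    (trans (nest-cong (suc k) r E (≋-reflexive ∘ graft-update-other d f W z≢x (∈-∉-≢ z∈V y∉V)))
           (nest≋C W))

graft-update₂-new : ∀ d f {x y} U W w → x ≢ y → w ≢ y →
  graft d (f [ x ≔ U ] [ y ≔ W ]) x y w ≡ (f [ x ≔ U ++ bracket d W ∷ [] ]) w
graft-update₂-new d f {x} {y} U W w x≢y w≢y = begin
  graft d (f [ x ≔ U ] [ y ≔ W ]) x y w
    ≡⟨ graft-update-leaf d (f [ x ≔ U ]) W w x≢y w≢y ⟩
  (f [ x ≔ U ] [ x ≔ (f [ x ≔ U ]) x ++ B ∷ [] ]) w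
    ≡⟨ cong (λ V → (f [ x ≔ U ] [ x ≔ V ++ B ∷ [] ]) w) (update-≡ f x U) ⟩
  (f [ x ≔ U ] [ x ≔ U ++ B ∷ [] ]) w
    ≡⟨ update-absorb f x U (U ++ B ∷ []) w ⟩
  (f [ x ≔ U ++ B ∷ [] ]) w ∎
  where
  open ≡.≡-Reasoning
  B = bracket d W

graft-update₂-source : ∀ d f {x y y′} U W → x ≢ y → x ≢ y′ → y ≢ y′ →
  graft d (f [ x ≔ U ] [ y ≔ W ]) x y′ ≗ f [ x ≔ U ++ bracket d (f y′) ∷ [] ] [ y ≔ W ]
graft-update₂-source d f {x} {y} U W x≢y x≢y′ y≢y′ w =
  ≡.trans (graft-update-other d (f [ x ≔ U ]) W (≢-sym x≢y) y≢y′ w)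
          (update-cong y W (graft-update-parent d f U x≢y′) w)

graft-update₂-target : ∀ d f {x y y′} U W → y ≢ y′ → x ≢ y′ →
  graft d (f [ x ≔ U ] [ y ≔ W ]) y y′ ≗ f [ x ≔ U ] [ y ≔ W ++ bracket d (f y′) ∷ [] ]
graft-update₂-target d f {x} {y} {y′} U W y≢y′ x≢y′ w =
  ≡.trans (graft-update-parent d (f [ x ≔ U ]) W y≢y′ w)
          (cong (λ V → (f [ x ≔ U ] [ y ≔ W ++ bracket d V ∷ [] ]) w) (update-≢ f U (≢-sym x≢y′)))

graft-update₂-other : ∀ d f {x y x′ y′} U W → x ≢ x′ → x ≢ y′ → y ≢ x′ → y ≢ y′ →
  graft d (f [ x ≔ U ] [ y ≔ W ]) x′ y′ ≗ graft d f x′ y′ [ x ≔ U ] [ y ≔ W ]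
graft-update₂-other d f {x} {y} U W x≢x′ x≢y′ y≢x′ y≢y′ w =
  ≡.trans (graft-update-other d (f [ x ≔ U ]) W y≢x′ y≢y′ w)
          (update-cong y W (graft-update-other d f U x≢x′ x≢y′) w)

nestWith : ℕ → ℕ → List Rel → Content → ℕ → ℕ → NSeq → NSeq → NSeq
nestWith n r E f x y U W = nest n r E (f [ x ≔ U ] [ y ≔ W ])

NestedIn : Dir → (NSeq → NSeq → NSeq) → Set
NestedIn d N = ∃[ X ] ∃[ Y ] ∀ U W → N U W ≋ plug X (U ++ bracket d (W ++ Y) ∷ [])

Adjacent : Dir → (NSeq → NSeq → NSeq) → Set
Adjacent d N = NestedIn d N ⊎ NestedIn (opposite d) (flip N)

NestedIn-resp : ∀ d {N M} → (∀ U W → N U W ≋ M U W) → NestedIn d M → NestedIn d N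
NestedIn-resp d N≋M (X , Y , M≋) = X , Y , λ U W → trans (N≋M U W) (M≋ U W)

NestedIn-appendOuter : ∀ d {N} A → NestedIn d N → NestedIn d (λ U W → N (U ++ A) W)
NestedIn-appendOuter d A (X , Y , N≋) = X ⊕ A , Y , λ U W →
  trans (N≋ (U ++ A) W) (trans (plug-cong X (↭⇒≋ (moveBack U _)))
    (≋-reflexive (≡.sym (plug-⊕ X A (U ++ bracket d (W ++ Y) ∷ [])))))
  where
  moveBack : ∀ U b → (U ++ A) ++ b ∷ [] ↭ (U ++ b ∷ []) ++ A
  moveBack U b = ↭.↭-trans (↭.↭-reflexive (++-assoc U A _))
                   (↭.↭-trans (↭.++⁺ˡ U (↭.++-comm A (b ∷ []))) (↭.↭-reflexive (≡.sym (++-assoc U (b ∷ []) A))))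

NestedIn-appendInner : ∀ d {N} A → NestedIn d N → NestedIn d (λ U W → N U (W ++ A))
NestedIn-appendInner d A (X , Y , N≋) = X , A ++ Y , λ U W →
  trans (N≋ U (W ++ A)) (≋-reflexive (cong (λ V → plug X (U ++ bracket d V ∷ [])) (++-assoc W A Y)))

NestedIn-inBracket : ∀ d e L {N} → NestedIn d N → NestedIn d (λ U W → L ++ bracket e (N U W) ∷ [])
NestedIn-inBracket d e L (X , Y , N≋) = inBracket e L X [] , Y , λ U W →
  trans (++⁺ˡ L (bracket-cong e (N≋ U W) ∷ [])) (≋-reflexive (≡.sym (plug-inBracket e L X [] _)))

Adjacent-resp : ∀ d {N M} → (∀ U W → N U W ≋ M U W) → Adjacent d M → Adjacent d N
Adjacent-resp d N≋M = Sum.map (NestedIn-resp d N≋M) (NestedIn-resp (opposite d) (flip N≋M))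

Adjacent-flip : ∀ d {N} → Adjacent d N → Adjacent (opposite d) (flip N)
Adjacent-flip future = Sum.swap
Adjacent-flip past   = Sum.swap

Adjacent-appendSource : ∀ d {N} A → Adjacent d N → Adjacent d (λ U W → N (U ++ A) W)
Adjacent-appendSource d A = Sum.map (NestedIn-appendOuter d A) (NestedIn-appendInner (opposite d) A)

Adjacent-appendTarget : ∀ d {N} A → Adjacent d N → Adjacent d (λ U W → N U (W ++ A))
Adjacent-appendTarget d A = Sum.map (NestedIn-appendInner d A) (NestedIn-appendOuter (opposite d) A)

Adjacent-inBracket : ∀ d e L {N} → Adjacent d N → Adjacent d (λ U W → L ++ bracket e (N U W) ∷ [])
Adjacent-inBracket d e L = Sum.map (NestedIn-inBracket d e L) (NestedIn-inBracket (opposite d) e L)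

adjacent-leaf : ∀ {V E} → Tree V E → ∀ {n} d {x y} → x ∈ V → y ∉ V → length (edge d x y ∷ E) ≤ n →
                ∀ {r} → r ∈ y ∷ V → ∀ f → Adjacent d (nestWith n r (edge d x y ∷ E) f x y)
adjacent-leaf {V} {E} T {suc k} d {x} {y} x∈V y∉V (s≤s E≤k) (here refl) f =
  inj₂ (hole [] [] , nestKids k x E f , λ W U →
  trans (≋-reflexive (nest-leafRoot k d E (f [ x ≔ U ] [ y ≔ W ]) (≢-sym x≢y) (Tree-untouched T y∉V)))
    (trans (++⁺ (≋-reflexive (update-≡ (f [ x ≔ U ]) y W)) (bracket-cong (opposite d)
             (++⁺ (≋-reflexive (≡.trans (update-≢ (f [ x ≔ U ]) W x≢y) (update-≡ f x U)))
                  (nestKids-local k x E (Tree-loopless T) λ w w≢x t →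
                    ≋-reflexive (≡.trans (update-≢ (f [ x ≔ U ]) W (∈-∉-≢ (Tree-touches T t) y∉V))
                                         (update-≢ f U w≢x)))) ∷ []))
      (≋-reflexive (≡.sym (++-identityʳ _)))))
  where x≢y = ∈-∉-≢ x∈V y∉V
adjacent-leaf {V} {E} T {suc k} d {x} {y} x∈V y∉V E<n {r} (there r∈V) f with focus T (<⇒≤ E<n) r∈V x∈V f
... | C , nest≋C = inj₁ (C , [] , λ U W →
  trans (nest-attachLeaf (suc k) r d E (f [ x ≔ U ] [ y ≔ W ]) x≢y (Tree-untouched T y∉V)
                         (∈-∉-≢ r∈V y∉V) E<n ℓ)
    (trans (nest-local (suc k) r E ℓ (grafted U W r∈V) (λ w _ t → grafted U W (Tree-touches T t)))
      (trans (nest≋C (U ++ bracket d W ∷ []))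
        (≋-reflexive (cong (λ V → plug C (U ++ bracket d V ∷ [])) (≡.sym (++-identityʳ W)))))))
  where
  x≢y = ∈-∉-≢ x∈V y∉V
  ℓ = Tree-loopless T
  grafted : ∀ U W {w} → w ∈ V → graft d (f [ x ≔ U ] [ y ≔ W ]) x y w ≋ (f [ x ≔ U ++ bracket d W ∷ [] ]) w
  grafted U W w∈V = ≋-reflexive (graft-update₂-new d f U W _ x≢y (∈-∉-≢ w∈V y∉V))

adjacent : ∀ {V E} → Tree V E → ∀ {n} → length E ≤ n → ∀ {r} → r ∈ V →
           ∀ d {x y} → edge d x y ∈ E → ∀ f → Adjacent d (nestWith n r E f x y)
adjacent (single _) _ _ d () f
adjacent (grow {E = E} {x′} {y′} d′ T x′∈V y′∉V) {n} E≤n {r} r∈V d (here eq) f with edge-≡⁻ d d′ eq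
... | inj₁ (refl , refl , refl) = adjacent-leaf T d x′∈V y′∉V E≤n r∈V f
... | inj₂ (refl , refl , refl) =
  Adjacent-resp (opposite d′)
    (λ U W → nest-cong n r (edge d′ x′ y′ ∷ E) (≋-reflexive ∘ update-comm f U W (≢-sym (∈-∉-≢ x′∈V y′∉V))))
    (Adjacent-flip d′ (adjacent-leaf T d′ x′∈V y′∉V E≤n r∈V f))
adjacent (grow {E = E} {x′} {y′} d′ T x′∈V y′∉V) {suc k} (s≤s E≤k) (here refl) d {x} {y} (there e∈E) f =
  Adjacent-resp d (λ U W → ≋-reflexive (≡.trans
      (nest-leafRoot k d′ E (f [ x ≔ U ] [ y ≔ W ]) (≢-sym (∈-∉-≢ x′∈V y′∉V)) (Tree-untouched T y′∉V))
      (cong (_++ _) (≡.trans (update-≢ (f [ x ≔ U ]) W (≢-sym y≢y′)) (update-≢ f U (≢-sym x≢y′))))))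
    (Adjacent-inBracket d (opposite d′) (f y′) (adjacent T E≤k x′∈V d e∈E f))
  where
  x≢y′ = ∈-∉-≢ (proj₁ (Tree-touches-edge T d e∈E)) y′∉V
  y≢y′ = ∈-∉-≢ (proj₂ (Tree-touches-edge T d e∈E)) y′∉V
adjacent (grow {E = E} {x′} {y′} d′ T x′∈V y′∉V) {suc k} E<n {r} (there r∈V) d {x} {y} (there e∈E) f =
  Adjacent-resp d (λ U W → nest-attachLeaf (suc k) r d′ E (f [ x ≔ U ] [ y ≔ W ]) (∈-∉-≢ x′∈V y′∉V)
                             (Tree-untouched T y′∉V) (∈-∉-≢ r∈V y′∉V) E<n (Tree-loopless T))
    (grafted (x′ ≟ x) (x′ ≟ y))
  where
  x∈V = proj₁ (Tree-touches-edge T d e∈E)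
  y∈V = proj₂ (Tree-touches-edge T d e∈E)
  x≢y = Loopless-edge (Tree-loopless T) d e∈E
  x≢y′ = ∈-∉-≢ x∈V y′∉V
  y≢y′ = ∈-∉-≢ y∈V y′∉V
  IH : ∀ f → Adjacent d (nestWith (suc k) r E f x y)
  IH = adjacent T (<⇒≤ E<n) r∈V d e∈E
  A = bracket d′ (f y′) ∷ []
  resp : ∀ (g : NSeq → NSeq → Content) → (∀ U W → graft d′ (f [ x ≔ U ] [ y ≔ W ]) x′ y′ ≗ g U W) →
         Adjacent d (λ U W → nest (suc k) r E (g U W)) →
         Adjacent d (λ U W → nest (suc k) r E (graft d′ (f [ x ≔ U ] [ y ≔ W ]) x′ y′))
  resp g eq = Adjacent-resp d λ U W → nest-cong (suc k) r E (≋-reflexive ∘ eq U W)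
  grafted : Dec (x′ ≡ x) → Dec (x′ ≡ y) →
            Adjacent d (λ U W → nest (suc k) r E (graft d′ (f [ x ≔ U ] [ y ≔ W ]) x′ y′))
  grafted (yes refl) _ =
    resp (λ U W → f [ x ≔ U ++ A ] [ y ≔ W ]) (λ U W → graft-update₂-source d′ f U W x≢y x≢y′ y≢y′)
      (Adjacent-appendSource d A (IH f))
  grafted (no _) (yes refl) =
    resp (λ U W → f [ x ≔ U ] [ y ≔ W ++ A ]) (λ U W → graft-update₂-target d′ f U W y≢y′ x≢y′)
      (Adjacent-appendTarget d A (IH f))
  grafted (no x′≢x) (no x′≢y) =
    resp (λ U W → graft d′ f x′ y′ [ x ≔ U ] [ y ≔ W ])
      (λ U W → graft-update₂-other d′ f U W (≢-sym x′≢x) x≢y′ (≢-sym x′≢y) y≢y′) (IH (graft d′ f x′ y′))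

fmsAt-here : ∀ x A Γ → fmsAt x ((x , A) ∷ Γ) ≡ fm A ∷ fmsAt x Γ
fmsAt-here x A Γ with x ≟ x
... | yes _   = refl
... | no x≢x = ⊥-elim (x≢x refl)

fmsAt-there : ∀ {w z} A Γ → w ≢ z → fmsAt w ((z , A) ∷ Γ) ≡ fmsAt w Γ
fmsAt-there {w} {z} A Γ w≢z with w ≟ z
... | yes w≡z = ⊥-elim (w≢z w≡z)
... | no _    = refl

fmsAt-absent : ∀ z Γ → z ∉ map proj₁ Γ → fmsAt z Γ ≡ []
fmsAt-absent z []            _    = refl
fmsAt-absent z ((y , A) ∷ Γ) z∉Γ =
  ≡.trans (fmsAt-there A Γ (z∉Γ ∘ here)) (fmsAt-absent z Γ (z∉Γ ∘ there))

fmsAt-filter : ∀ w Γ → fmsAt w Γ ≡ map (fm ∘ proj₂) (filter (λ a → w ≟ proj₁ a) Γ)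
fmsAt-filter w []            = refl
fmsAt-filter w ((y , A) ∷ Γ) with w ≟ y
... | yes w≡y = ≡.trans (cong (fm A ∷_) (fmsAt-filter w Γ))
                  (cong (map (fm ∘ proj₂)) (≡.sym (filter-accept (λ a → w ≟ proj₁ a) w≡y)))
... | no w≢y  = ≡.trans (fmsAt-filter w Γ)
                  (cong (map (fm ∘ proj₂)) (≡.sym (filter-reject (λ a → w ≟ proj₁ a) w≢y)))

fmsAt-↭ : ∀ w {Γ Γ′} → Γ ↭ Γ′ → fmsAt w Γ ↭ fmsAt w Γ′
fmsAt-↭ w {Γ} {Γ′} p = ≡.subst₂ _↭_ (≡.sym (fmsAt-filter w Γ)) (≡.sym (fmsAt-filter w Γ′))
  (↭.map⁺ (fm ∘ proj₂) (↭.filter-↭ (λ a → w ≟ proj₁ a) p))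

fmsAt-prefix : ∀ x Δ Γ → fmsAt x (map (x ,_) Δ ++ Γ) ≡ map fm Δ ++ fmsAt x Γ
fmsAt-prefix x []      Γ = refl
fmsAt-prefix x (A ∷ Δ) Γ = ≡.trans (fmsAt-here x A _) (cong (fm A ∷_) (fmsAt-prefix x Δ Γ))

fmsAt-prefix-other : ∀ {w x} Δ Γ → w ≢ x → fmsAt w (map (x ,_) Δ ++ Γ) ≡ fmsAt w Γ
fmsAt-prefix-other []      Γ w≢x = refl
fmsAt-prefix-other (A ∷ Δ) Γ w≢x = ≡.trans (fmsAt-there A _ w≢x) (fmsAt-prefix-other Δ Γ w≢x)

-- The extra content e lets the translation carry formulae that DKT keeps but G3Kt drops.
contents : List LF → Content → Content
contents Γ e w = fmsAt w Γ ++ e w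

contents-prefix : ∀ x Δ Γ e →
  contents (map (x ,_) Δ ++ Γ) e ≗ contents Γ e [ x ≔ map fm Δ ++ contents Γ e x ]
contents-prefix x Δ Γ e w with w ≟ x
... | yes refl = ≡.trans (cong (_++ e w) (fmsAt-prefix w Δ Γ)) (++-assoc (map fm Δ) (fmsAt w Γ) (e w))
... | no w≢x   = cong (_++ e w) (fmsAt-prefix-other Δ Γ w≢x)

contents-edge : ∀ {x y} D Γ e Δ → x ≢ y →
  contents (map (y ,_) Δ ++ (x , D) ∷ Γ) e ≗
  contents Γ e [ x ≔ fm D ∷ contents Γ e x ] [ y ≔ map fm Δ ++ contents Γ e y ]
contents-edge {x} {y} D Γ e Δ x≢y w with w ≟ y
... | yes refl = ≡.trans (contents-prefix y Δ ((x , D) ∷ Γ) e y)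
                   (≡.trans (update-≡ (contents ((x , D) ∷ Γ) e) y _)
                            (cong (λ u → map fm Δ ++ u ++ e y) (fmsAt-there D Γ (≢-sym x≢y))))
... | no w≢y   = ≡.trans (contents-prefix y Δ ((x , D) ∷ Γ) e w)
                   (≡.trans (update-≢ (contents ((x , D) ∷ Γ) e) _ w≢y) (contents-prefix x (D ∷ []) Γ e w))

contents-fresh : ∀ d {x y} A B Γ e {w} → x ≢ y → y ∉ map proj₁ Γ → w ≢ y →
  graft d (contents ((y , A) ∷ Γ) (e [ x ≔ fm B ∷ e x ] [ y ≔ [] ])) x y w ≋
  (contents Γ e [ x ≔ fm B ∷ bracket d (fm A ∷ []) ∷ contents Γ e x ]) w
contents-fresh d {x} {y} A B Γ e {w} x≢y y∉Γ w≢y = by-cases (w ≟ x)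
  where
  e′ = e [ x ≔ fm B ∷ e x ] [ y ≔ [] ]
  b = bracket d (fm A ∷ [])
  g = contents Γ e
  by-cases : Dec (w ≡ x) → graft d (contents ((y , A) ∷ Γ) e′) x y w ≋ (g [ x ≔ fm B ∷ b ∷ g x ]) w
  by-cases (yes refl) =
    trans (≋-reflexive (≡.trans (update-≡ (contents ((y , A) ∷ Γ) e′) w _)
                                (cong₂ (λ U V → U ++ bracket d V ∷ []) content-x content-y)))
      (trans (↭⇒≋ reorder) (≋-reflexive (≡.sym (update-≡ g w _))))
    where
    content-x : fmsAt w ((y , A) ∷ Γ) ++ e′ w ≡ fmsAt w Γ ++ fm B ∷ e w
    content-x = cong₂ _++_ (fmsAt-there A Γ x≢y)
                  (≡.trans (update-≢ (e [ w ≔ fm B ∷ e w ]) [] x≢y) (update-≡ e w _))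
    content-y : fmsAt y ((y , A) ∷ Γ) ++ e′ y ≡ fm A ∷ []
    content-y = cong₂ _++_ (≡.trans (fmsAt-here y A Γ) (cong (fm A ∷_) (fmsAt-absent y Γ y∉Γ)))
                  (update-≡ (e [ x ≔ fm B ∷ e x ]) y [])
    reorder : (fmsAt w Γ ++ fm B ∷ e w) ++ b ∷ [] ↭ fm B ∷ b ∷ fmsAt w Γ ++ e w
    reorder = ↭.↭-trans (↭.++-comm (fmsAt w Γ ++ fm B ∷ e w) (b ∷ []))
                (↭.↭-trans (↭.prep b (↭.shift (fm B) (fmsAt w Γ) (e w))) (↭.swap b (fm B) ↭.refl))
  by-cases (no w≢x) = ≋-reflexive (begin
    graft d (contents ((y , A) ∷ Γ) e′) x y w
      ≡⟨ update-≢ (contents ((y , A) ∷ Γ) e′) _ w≢x ⟩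
    fmsAt w ((y , A) ∷ Γ) ++ e′ w
      ≡⟨ cong₂ _++_ (fmsAt-there A Γ w≢y) (≡.trans (update-≢ (e [ x ≔ fm B ∷ e x ]) [] w≢y) (update-≢ e _ w≢x)) ⟩
    g w
      ≡⟨ ≡.sym (update-≢ g _ w≢x) ⟩
    (g [ x ≔ fm B ∷ b ∷ g x ]) w ∎)
    where open ≡.≡-Reasoning

∈-labels-incident : ∀ {R w} Γ e → e ∈ R → Incident w e → w ∈ labels (R , Γ)
∈-labels-incident     Γ (a , b) e∈R (inj₁ refl) = ∈-++⁺ˡ (∈-map⁺ proj₁ e∈R)
∈-labels-incident {R} Γ (a , b) e∈R (inj₂ refl) = ∈-++⁺ʳ (map proj₁ R) (∈-++⁺ˡ (∈-map⁺ proj₂ e∈R))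

∈-labels-formula : ∀ R Γ {w} → w ∈ map proj₁ Γ → w ∈ labels (R , Γ)
∈-labels-formula R Γ w∈Γ = ∈-++⁺ʳ (map proj₁ R) (∈-++⁺ʳ (map proj₂ R) w∈Γ)

labels-⊆ : ∀ {R Γ R′ Γ′} → R ⊆ R′ → map proj₁ Γ ⊆ labels (R′ , Γ′) → labels (R , Γ) ⊆ labels (R′ , Γ′)
labels-⊆ {R} {Γ} {R′} {Γ′} R⊆R′ Γ⊆ w∈ with ∈-++⁻ (map proj₁ R) w∈
... | inj₁ w∈R₁ with ∈-map⁻ proj₁ w∈R₁
...   | e , e∈R , refl = ∈-labels-incident Γ′ e (R⊆R′ e∈R) (inj₁ refl)
labels-⊆ {R} {Γ} {R′} {Γ′} R⊆R′ Γ⊆ w∈ | inj₂ w∈′ with ∈-++⁻ (map proj₂ R) w∈′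
...   | inj₁ w∈R₂ with ∈-map⁻ proj₂ w∈R₂
...     | e , e∈R , refl = ∈-labels-incident Γ′ e (R⊆R′ e∈R) (inj₂ refl)
labels-⊆ R⊆R′ Γ⊆ w∈ | inj₂ w∈′ | inj₂ w∈Γ = Γ⊆ w∈Γ

labels-∷ : ∀ R Γ y A → labels (R , Γ) ⊆ labels (R , (y , A) ∷ Γ)
labels-∷ R Γ y A = labels-⊆ {R} {Γ} {R} {(y , A) ∷ Γ} id (∈-labels-formula R ((y , A) ∷ Γ) ∘ there)

labels-fresh : ∀ d R Γ x y A B → labels (R , (x , B) ∷ Γ) ⊆ labels (edge d x y ∷ R , (y , A) ∷ Γ)
labels-fresh d R Γ x y A B = labels-⊆ {R} {(x , B) ∷ Γ} {edge d x y ∷ R} {(y , A) ∷ Γ} there λ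
  { (here refl) → ∈-labels-incident ((y , A) ∷ Γ) (edge d x y) (here refl) (source-incident d)
  ; (there w∈Γ) → ∈-labels-formula (edge d x y ∷ R) ((y , A) ∷ Γ) (there w∈Γ) }

-- Translating derivations

focusAt : ∀ {R Γ x B r} → Polytree (R , (x , B) ∷ Γ) → r ∈ labels (R , (x , B) ∷ Γ) →
          ∀ f → Focus (length R) r R f x
focusAt {R} {Γ} {x} {B} {r} (V , E , T , E↭R , iff) r∈ f
  with focus (fromTreeG T) (≤-reflexive (↭.↭-length E↭R)) (Equivalence.from (iff r) r∈)
             (Equivalence.from (iff x) (∈-labels-formula R ((x , B) ∷ Γ) (here refl))) f
... | C , nest≋C = C , λ W → trans (nest-↭ (length R) r (f [ x ≔ W ]) (↭.↭-sym E↭R)) (nest≋C W)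

focus-prefix : ∀ {n r R x} Γ e (F : Focus n r R (contents Γ e) x) Δ →
  nest n r R (contents (map (x ,_) Δ ++ Γ) e) ≋ plug (Focus.context F) (map fm Δ ++ contents Γ e x)
focus-prefix {n} {r} {R} {x} Γ e (C , nest≋C) Δ =
  trans (nest-cong n r R (≋-reflexive ∘ contents-prefix x Δ Γ e)) (nest≋C _)

DKT-toHole : ∀ C W P {N} → DKT N → N ≋ plug C (P ++ W) → DKT (plug (C ⊕ W) P)
DKT-toHole C W P d N≋ = DKT-resp-≋ (trans N≋ (≋-reflexive (≡.sym (plug-⊕ C W P)))) d

DKT-fromHole : ∀ C W Q {M} → DKT (plug (C ⊕ W) Q) → M ≋ plug C (Q ++ W) → DKT M
DKT-fromHole C W Q d M≋ = DKT-resp-≋ (trans (≋-reflexive (plug-⊕ C W Q)) (≋-sym M≋)) d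

swapLast : ∀ (a b : Item) L → a ∷ L ++ b ∷ [] ≋ b ∷ a ∷ L
swapLast a b L = ↭⇒≋ (↭.↭-trans (↭.prep a (↭.++-comm L (b ∷ []))) (↭.swap a b ↭.refl))

translate-fresh : ∀ d {R Γ x y A B r} e →
  (∀ {X} → DKT (plug X (fm B ∷ bracket d (fm A ∷ []) ∷ [])) → DKT (plug X (fm B ∷ []))) →
  Polytree (R , (x , B) ∷ Γ) → y ∉ labels (R , (x , B) ∷ Γ) → r ∈ labels (R , (x , B) ∷ Γ) →
  DKT (nest (suc (length R)) r (edge d x y ∷ R)
            (contents ((y , A) ∷ Γ) (e [ x ≔ fm B ∷ e x ] [ y ≔ [] ]))) →
  DKT (nest (length R) r R (contents ((x , B) ∷ Γ) e))
translate-fresh d {R} {Γ} {x} {y} {A} {B} {r} e rule pt@(V , E , T , E↭R , iff) y∉ r∈ premise =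
  DKT-fromHole C (g x) (fm B ∷ [])
    (rule {C ⊕ g x} (DKT-toHole C (g x) (fm B ∷ b ∷ []) premise premise≋))
    (focus-prefix Γ e F (B ∷ []))
  where
  tree = fromTreeG T
  n = length R
  E≤n : length E ≤ n
  E≤n = ≤-reflexive (↭.↭-length E↭R)
  y∉V : y ∉ V
  y∉V y∈V = y∉ (Equivalence.to (iff y) y∈V)
  r∈V : r ∈ V
  r∈V = Equivalence.from (iff r) r∈
  x≢y : x ≢ y
  x≢y = ∈-∉-≢ (Equivalence.from (iff x) (∈-labels-formula R ((x , B) ∷ Γ) (here refl))) y∉V
  g = contents Γ e
  b = bracket d (fm A ∷ [])
  F : Focus n r R g x
  F = focusAt {R} {Γ} {x} {B} pt r∈ g
  C = Focus.context F
  c₁ = contents ((y , A) ∷ Γ) (e [ x ≔ fm B ∷ e x ] [ y ≔ [] ])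
  fresh : ∀ {w} → w ∈ V → graft d c₁ x y w ≋ (g [ x ≔ fm B ∷ b ∷ g x ]) w
  fresh w∈V = contents-fresh d A B Γ e x≢y (λ y∈Γ → y∉ (∈-labels-formula R ((x , B) ∷ Γ) (there y∈Γ)))
                (∈-∉-≢ w∈V y∉V)
  premise≋ : nest (suc n) r (edge d x y ∷ R) c₁ ≋ plug C ((fm B ∷ b ∷ []) ++ g x)
  premise≋ =
    trans (nest-↭ (suc n) r c₁ (↭.prep _ (↭.↭-sym E↭R)))
    (trans (nest-attachLeaf (suc n) r d E c₁ x≢y (Tree-untouched tree y∉V) (∈-∉-≢ r∈V y∉V) (s≤s E≤n)
                            (Tree-loopless tree))
    (trans (nest-fuel n r E _ E≤n)
    (trans (nest-local n r E (Tree-loopless tree) (fresh r∈V) (λ w _ t → fresh (Tree-touches tree t)))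
    (trans (nest-↭ n r _ E↭R)
    (Focus.nest≋plug F _)))))

translate-diamond : ∀ d {R Γ x y A D r} e →
  (∀ {X Y} → DKT (plug X (bracket d (fm A ∷ Y) ∷ fm D ∷ [])) →
             DKT (plug X (bracket d Y ∷ fm D ∷ []))) →
  (∀ {X Y} → DKT (plug X (bracket (opposite d) (fm D ∷ Y) ∷ fm A ∷ [])) →
             DKT (plug X (bracket (opposite d) (fm D ∷ Y) ∷ []))) →
  Polytree (edge d x y ∷ R , (x , D) ∷ Γ) → r ∈ labels (edge d x y ∷ R , (x , D) ∷ Γ) →
  DKT (nest (length (edge d x y ∷ R)) r (edge d x y ∷ R) (contents ((y , A) ∷ (x , D) ∷ Γ) e)) →
  DKT (nest (length (edge d x y ∷ R)) r (edge d x y ∷ R) (contents ((x , D) ∷ Γ) e))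
translate-diamond d {R} {Γ} {x} {y} {A} {D} {r} e down up (V , E , T₀ , E↭R′ , iff) r∈ premise =
  DKT-resp-≋ (≋-sym (via []))
    (apply (adjacent tree (≤-reflexive (↭.↭-length E↭R′)) (Equivalence.from (iff r) r∈) d e∈E g))
  where
  R′ = edge d x y ∷ R
  n = length R′
  tree = fromTreeG T₀
  e∈E : edge d x y ∈ E
  e∈E = ↭.∈-resp-↭ (↭.↭-sym E↭R′) (here refl)
  g = contents Γ e
  N = nestWith n r E g x y
  via : ∀ Δ → nest n r R′ (contents (map (y ,_) Δ ++ (x , D) ∷ Γ) e) ≋ N (fm D ∷ g x) (map fm Δ ++ g y)
  via Δ = trans (nest-↭ n r _ (↭.↭-sym E↭R′))
                (nest-cong n r E (≋-reflexive ∘ contents-edge D Γ e Δ (Loopless-edge (Tree-loopless tree) d e∈E)))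
  premise′ : DKT (N (fm D ∷ g x) (fm A ∷ g y))
  premise′ = DKT-resp-≋ (via (A ∷ [])) premise
  apply : Adjacent d N → DKT (N (fm D ∷ g x) (g y))
  apply (inj₁ (X , Y , N≋)) =
    DKT-fromHole X (g x) (bracket d (g y ++ Y) ∷ fm D ∷ [])
      (down {X ⊕ g x} {g y ++ Y} (DKT-toHole X (g x) (bracket d (fm A ∷ g y ++ Y) ∷ fm D ∷ []) premise′
        (trans (N≋ _ _) (plug-cong X (swapLast _ _ _)))))
      (trans (N≋ _ _) (plug-cong X (swapLast _ _ _)))
  apply (inj₂ (X , Y , N≋)) =
    DKT-fromHole X (g y) (bracket (opposite d) (fm D ∷ g x ++ Y) ∷ [])
      (up {X ⊕ g y} {g x ++ Y}
        (DKT-toHole X (g y) (bracket (opposite d) (fm D ∷ g x ++ Y) ∷ fm A ∷ []) premise′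
        (trans (N≋ _ _) (plug-cong X (swapLast _ _ _)))))
      (trans (N≋ _ _) (plug-cong X (↭⇒≋ (↭.++-comm (g y) _))))

translate : ∀ {R Γ} (d : G3Kt (R , Γ)) → AllPolytree d → ∀ {r} → r ∈ labels (R , Γ) → ∀ e →
            DKT (nest (length R) r R (contents Γ e))
translate (ax {R} {Γ} {x} {p}) pt r∈ e =
  DKT-fromHole C W (map fm (at p ∷ nat p ∷ [])) (ax {C ⊕ W}) (focus-prefix Γ e F (at p ∷ nat p ∷ []))
  where
  F = focusAt {R} {(x , nat p) ∷ Γ} {x} {at p} pt r∈ (contents Γ e)
  C = Focus.context F
  W = contents Γ e x
translate (r∨ {R} {Γ} {x} {A} {B} d) (pt , ap) r∈ e =
  DKT-fromHole C W (map fm (A ∨ᶠ B ∷ []))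
    (r∨ {C ⊕ W} (DKT-toHole C W (map fm (A ∷ B ∷ []))
      (translate d ap (labels-∷ R ((x , B) ∷ Γ) x A r∈) e) (focus-prefix Γ e F (A ∷ B ∷ []))))
    (focus-prefix Γ e F (A ∨ᶠ B ∷ []))
  where
  F = focusAt {R} {Γ} {x} {A ∨ᶠ B} pt r∈ (contents Γ e)
  C = Focus.context F
  W = contents Γ e x
translate (r∧ {R} {Γ} {x} {A} {B} d d′) (pt , ap , ap′) r∈ e =
  DKT-fromHole C W (map fm (A ∧ᶠ B ∷ []))
    (r∧ {C ⊕ W} (DKT-toHole C W (map fm (A ∷ [])) (translate d ap r∈ e) (focus-prefix Γ e F (A ∷ [])))
                (DKT-toHole C W (map fm (B ∷ [])) (translate d′ ap′ r∈ e) (focus-prefix Γ e F (B ∷ []))))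
    (focus-prefix Γ e F (A ∧ᶠ B ∷ []))
  where
  F = focusAt {R} {Γ} {x} {A ∧ᶠ B} pt r∈ (contents Γ e)
  C = Focus.context F
  W = contents Γ e x
translate (r□ {R} {Γ} {x} {y} {A} y∉ d) (pt , ap) r∈ e =
  translate-fresh future {R} {Γ} {x} {y} {A} {□ A} e (λ {X} → r□ {X} {A}) pt y∉ r∈
    (translate d ap (labels-fresh future R Γ x y A (□ A) r∈) (e [ x ≔ fm (□ A) ∷ e x ] [ y ≔ [] ]))
translate (r■ {R} {Γ} {x} {y} {A} y∉ d) (pt , ap) r∈ e =
  translate-fresh past {R} {Γ} {x} {y} {A} {■ A} e (λ {X} → r■ {X} {A}) pt y∉ r∈
    (translate d ap (labels-fresh past R Γ x y A (■ A) r∈) (e [ x ≔ fm (■ A) ∷ e x ] [ y ≔ [] ]))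
translate (r◇ {R} {Γ} {x} {y} {A} d) (pt , ap) r∈ e =
  translate-diamond future {R} {Γ} {x} {y} {A} {◇ A} e
    (λ {X} {Y} → r◇₁ {X} {Y} {A}) (λ {X} {Y} → r◇₂ {X} {Y} {A}) pt r∈
    (translate d ap (labels-∷ ((x , y) ∷ R) ((x , ◇ A) ∷ Γ) y A r∈) e)
translate (r◇⁻ {R} {Γ} {x} {y} {A} d) (pt , ap) r∈ e =
  translate-diamond past {R} {Γ} {x} {y} {A} {◇⁻ A} e
    (λ {X} {Y} → r◇⁻₁ {X} {Y} {A}) (λ {X} {Y} → r◇⁻₂ {X} {Y} {A}) pt r∈
    (translate d ap (labels-∷ ((y , x) ∷ R) ((x , ◇⁻ A) ∷ Γ) y A r∈) e)
translate (ex {R} {R′} {Γ} {Γ′} d R↭R′ Γ↭Γ′) (pt , ap) {r} r∈ e =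
  subst (λ n → DKT (nest n r R′ (contents Γ′ e))) (↭.↭-length R↭R′)
    (DKT-resp-≋ (trans (nest-↭ (length R) r (contents Γ e) R↭R′)
                       (nest-cong (length R) r R′ λ w → ↭⇒≋ (↭.++⁺ʳ (e w) (fmsAt-↭ w Γ↭Γ′))))
      (translate d ap (↭.∈-resp-↭ (↭.↭-sym labels↭) r∈) e))
  where
  labels↭ : labels (R , Γ) ↭ labels (R′ , Γ′)
  labels↭ = ↭.++⁺ (↭.map⁺ proj₁ R↭R′) (↭.++⁺ (↭.map⁺ proj₂ R↭R′) (↭.map⁺ proj₁ Γ↭Γ′))

lemma5p3 : ∀ {S} (d : G3Kt S) → AllPolytree d →
           (x : ℕ) → x ∈ labels S → DKT (𝔑 x S)
lemma5p3 {R , Γ} d ap x x∈ =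
  subst DKT (≡.sym (tr≡nest (length R) x R Γ))
    (DKT-resp-≋ (nest-cong (length R) x R λ w → ≋-reflexive (++-identityʳ (fmsAt w Γ)))
      (translate d ap x∈ (λ _ → [])))
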